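{- Suppose $d_V$ is the symmetric distance of $\mathbf{V}$ and $D$ an ultrafilter on $I$. If $(M_i,d_{M_i})_{i\in I}$ are $\mathbf{V}$-continuity spaces, then $(\prod_{i\in I}M_i,d_D)$ is a $\mathbf{V}$-continuity space, where $d_D((x_i)_i,(y_i)_i):=\lim_{i,D}d_{M_i}(x_i,y_i)$.
   Context: $\mathbf{V}$ is a value co-quantale and $\mathbf{V}$-domain, $a\mathbin{\dot{ - }} b:=\bigwedge\{r:r+b\ge a\}$, $d_V(p,q)=(p\mathbin{\dot{ - }} q)\vee(q\mathbin{\dot{ - }} p)$; $\lim_{i,D}a_i$ is the unique $a$ with $\{i:d_V(a,a_i)\le\epsilon\}\in D$ for all $\epsilon$ with $0\prec\epsilon$. A $\mathbf{V}$-continuity space $(X,d)$ satisfies $d(x,x)=0$ and $d(x,y)\le d(x,z)+d(z,y)$ (not necessarily symmetric). -}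

module Defs where

open import Level using (Level) renaming (suc to lsuc; zero to lzero)
open import Data.Product using (Σ; Σ-syntax; ∃; _×_; _,_; proj₁; proj₂)
open import Data.Sum using (_⊎_)
open import Data.Empty using (⊥)
open import Data.Unit using (⊤)
open import Relation.Nullary using (¬_)
open import Relation.Binary.PropositionalEquality using (_≡_)

Subset : Set → Set₁
Subset A = A → Set

-- Value co-quantales (Flagg's value quantales, written in the
-- "co" convention: 0 is the bottom and the unit of +, and + distributes
-- over arbitrary meets).

record ValueCoQuantale : Set₁ where
  infix  4 _≤_ _≺_
  infixl 6 _+_
  field
    Carrier : Set
    _≤_     : Carrier → Carrier → Set
    ≤-refl    : ∀ {a} → a ≤ a
    ≤-trans   : ∀ {a b c} → a ≤ b → b ≤ c → a ≤ c
    ≤-antisym : ∀ {a b} → a ≤ b → b ≤ a → a ≡ b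
    ⋀          : Subset Carrier → Carrier
    ⋀-lower    : ∀ (S : Subset Carrier) {s} → S s → ⋀ S ≤ s
    ⋀-greatest : ∀ (S : Subset Carrier) {a} → (∀ {s} → S s → a ≤ s) → a ≤ ⋀ S
    _+_     : Carrier → Carrier → Carrier
    0#      : Carrier
    +-assoc : ∀ a b c → (a + b) + c ≡ a + (b + c)
    +-comm  : ∀ a b → a + b ≡ b + a
    +-identityʳ : ∀ a → a + 0# ≡ a
    0-bottom : ∀ a → 0# ≤ a
    +-⋀ : ∀ a (S : Subset Carrier) →
          a + ⋀ S ≡ ⋀ (λ t → Σ[ s ∈ Carrier ] (S s × t ≡ a + s))

    -- well-above relation: a ≺ b iff whenever ⋀S ≤ a, some s ∈ S has s ≤ b.
    -- (Given as a Set-valued relation together with its defining property,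
    -- to avoid a universe-size problem when forming ⋀{b : a ≺ b}.)
    _≺_   : Carrier → Carrier → Set
    ≺-def : ∀ {a b} →
            (a ≺ b → ∀ (S : Subset Carrier) → ⋀ S ≤ a → Σ[ s ∈ Carrier ] (S s × s ≤ b))
          × ((∀ (S : Subset Carrier) → ⋀ S ≤ a → Σ[ s ∈ Carrier ] (S s × s ≤ b)) → a ≺ b)

  ⊤V : Carrier
  ⊤V = ⋀ (λ _ → ⊥)

  _∧_ : Carrier → Carrier → Carrier
  a ∧ b = ⋀ (λ r → r ≡ a ⊎ r ≡ b)

  _∨_ : Carrier → Carrier → Carrier
  a ∨ b = ⋀ (λ r → a ≤ r × b ≤ r)

  field
    -- value distributivity: complete distributivity (in Raney's form
    -- a = ⋀{b : a ≺ b}), 0 ≠ ⊤, and positives closed under ∧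
    approx    : ∀ a → a ≡ ⋀ (λ b → a ≺ b)
    0≢⊤       : ¬ (0# ≡ ⊤V)
    ≺-∧       : ∀ {ε δ} → 0# ≺ ε → 0# ≺ δ → 0# ≺ (ε ∧ δ)

  _∸_ : Carrier → Carrier → Carrier
  a ∸ b = ⋀ (λ r → a ≤ r + b)

  dV : Carrier → Carrier → Carrier
  dV p q = (p ∸ q) ∨ (q ∸ p)

record Ultrafilter (I : Set) : Set₁ where
  field
    InD      : Subset I → Set
    full     : InD (λ _ → ⊤)
    no-empty : ¬ (InD (λ _ → ⊥))
    upward   : ∀ {A B : Subset I} → (∀ {i} → A i → B i) → InD A → InD B
    meet     : ∀ {A B : Subset I} → InD A → InD B → InD (λ i → A i × B i)
    ultra    : ∀ (A : Subset I) → InD A ⊎ InD (λ i → ¬ A i)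

module _ (V : ValueCoQuantale) where
  open ValueCoQuantale V

  IsLim : {I : Set} → Ultrafilter I → (I → Carrier) → Carrier → Set
  IsLim D as a = ∀ ε → 0# ≺ ε → Ultrafilter.InD D (λ i → dV a (as i) ≤ ε)

  -- standing assumption making lim_{i,D} a well-defined:
  -- ultralimits in (V, d_V) exist and are unique
  UniqueUltralimits : Set₁
  UniqueUltralimits = ∀ (I : Set) (D : Ultrafilter I) (as : I → Carrier) →
    Σ[ a ∈ Carrier ] (IsLim D as a × (∀ b → IsLim D as b → b ≡ a))

  lim : UniqueUltralimits → {I : Set} → Ultrafilter I → (I → Carrier) → Carrier
  lim U {I} D as = proj₁ (U I D as)

  IsContinuitySpace : (X : Set) → (X → X → Carrier) → Set
  IsContinuitySpace X d = (∀ x → d x x ≡ 0#) × (∀ x y z → d x y ≤ d x z + d z y)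

  dD : UniqueUltralimits → {I : Set} → Ultrafilter I → (M : I → Set) →
       (∀ i → M i → M i → Carrier) → ((i : I) → M i) → ((i : I) → M i) → Carrier
  dD U D M dM x y = lim U D (λ i → dM i (x i) (y i))

{-# OPTIONS --safe #-}
-- Each axiom of a continuity space passes to the ultraproduct because
-- D-limits in (V, d_V) preserve the pointwise structure: a constant 0 has
-- limit 0, limits are monotone, and the limit of a sum is the sum of the
-- limits. Monotonicity is where uniqueness of limits is used: if aᵢ ≤ sᵢ
-- with limits a and s, then a ∧ s is another limit of (aᵢ), so a = a ∧ s ≤ s.
module Submission where

open import Defs
open import Algebra.Bundles using (CommutativeSemigroup)
import Algebra.Properties.CommutativeSemigroup as CommutativeSemigroupProperties
open import Data.Product using (Σ-syntax; _×_; _,_; proj₁; proj₂)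
open import Data.Sum using (inj₁; inj₂)
open import Relation.Binary.PropositionalEquality
  using (_≡_; refl; sym; trans; cong; cong₂; isEquivalence)

module Properties (V : ValueCoQuantale) where
  open ValueCoQuantale V

  ≡⇒≤ : ∀ {a b} → a ≡ b → a ≤ b
  ≡⇒≤ refl = ≤-refl

  ⋀-principal : ∀ a → ⋀ (a ≤_) ≡ a
  ⋀-principal a = ≤-antisym (⋀-lower _ ≤-refl) (⋀-greatest _ (λ a≤s → a≤s))

  +-⋀-lower : ∀ z (S : Subset Carrier) {s} → S s → z + ⋀ S ≤ z + s
  +-⋀-lower z S {s} s∈S = ≤-trans (≡⇒≤ (+-⋀ z S)) (⋀-lower _ (s , s∈S , refl))

  +-⋀-greatest : ∀ z (S : Subset Carrier) {u} →
                 (∀ {s} → S s → u ≤ z + s) → u ≤ z + ⋀ S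
  +-⋀-greatest z S u≤z+S =
    ≤-trans (⋀-greatest _ (λ { (_ , s∈S , refl) → u≤z+S s∈S }))
            (≡⇒≤ (sym (+-⋀ z S)))

  +-monoʳ-≤ : ∀ z {x y} → x ≤ y → z + x ≤ z + y
  +-monoʳ-≤ z {x} {y} x≤y =
    ≤-trans (≡⇒≤ (cong (z +_) (sym (⋀-principal x)))) (+-⋀-lower z (x ≤_) x≤y)

  +-monoˡ-≤ : ∀ z {x y} → x ≤ y → x + z ≤ y + z
  +-monoˡ-≤ z {x} {y} x≤y =
    ≤-trans (≡⇒≤ (+-comm x z)) (≤-trans (+-monoʳ-≤ z x≤y) (≡⇒≤ (+-comm z y)))

  +-mono-≤ : ∀ {a b c d} → a ≤ b → c ≤ d → a + c ≤ b + d
  +-mono-≤ {b = b} {c} a≤b c≤d = ≤-trans (+-monoˡ-≤ c a≤b) (+-monoʳ-≤ b c≤d)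

  x≤y+x : ∀ x y → x ≤ y + x
  x≤y+x x y =
    ≤-trans (≡⇒≤ (sym (+-identityʳ x)))
            (≤-trans (+-monoʳ-≤ x (0-bottom y)) (≡⇒≤ (+-comm x y)))

  +-commutativeSemigroup : CommutativeSemigroup _ _
  +-commutativeSemigroup = record
    { Carrier = Carrier
    ; _≈_ = _≡_
    ; _∙_ = _+_
    ; isCommutativeSemigroup = record
      { isSemigroup = record
        { isMagma = record { isEquivalence = isEquivalence ; ∙-cong = cong₂ _+_ }
        ; assoc = +-assoc
        }
      ; comm = +-comm
      }
    }

  open CommutativeSemigroupProperties +-commutativeSemigroup
    using () renaming (interchange to +-interchange)

  ∧-lowerˡ : ∀ {p q} → p ∧ q ≤ p
  ∧-lowerˡ = ⋀-lower _ (inj₁ refl)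

  ∧-lowerʳ : ∀ {p q} → p ∧ q ≤ q
  ∧-lowerʳ = ⋀-lower _ (inj₂ refl)

  +-∧-greatest : ∀ z {p q u} → u ≤ z + p → u ≤ z + q → u ≤ z + (p ∧ q)
  +-∧-greatest z u≤z+p u≤z+q =
    +-⋀-greatest z _ (λ { (inj₁ refl) → u≤z+p ; (inj₂ refl) → u≤z+q })

  ∨-upperˡ : ∀ {p q} → p ≤ p ∨ q
  ∨-upperˡ = ⋀-greatest _ proj₁

  ∨-upperʳ : ∀ {p q} → q ≤ p ∨ q
  ∨-upperʳ = ⋀-greatest _ proj₂

  ∨-least : ∀ {p q e} → p ≤ e → q ≤ e → p ∨ q ≤ e
  ∨-least p≤e q≤e = ⋀-lower _ (p≤e , q≤e)

  x≤x∸y+y : ∀ x y → x ≤ (x ∸ y) + y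
  x≤x∸y+y x y =
    ≤-trans (+-⋀-greatest y _ (λ {s} x≤s+y → ≤-trans x≤s+y (≡⇒≤ (+-comm s y))))
            (≡⇒≤ (+-comm y (x ∸ y)))

  ∸≤⇒≤+ : ∀ {x y ε} → x ∸ y ≤ ε → x ≤ ε + y
  ∸≤⇒≤+ {x} {y} x∸y≤ε = ≤-trans (x≤x∸y+y x y) (+-monoˡ-≤ y x∸y≤ε)

  dV≤⇒≤+ˡ : ∀ {u v ε} → dV u v ≤ ε → u ≤ ε + v
  dV≤⇒≤+ˡ d≤ε = ∸≤⇒≤+ (≤-trans ∨-upperˡ d≤ε)

  dV≤⇒≤+ʳ : ∀ {u v ε} → dV u v ≤ ε → v ≤ ε + u
  dV≤⇒≤+ʳ d≤ε = ∸≤⇒≤+ (≤-trans ∨-upperʳ d≤ε)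

  ≤+⇒dV≤ : ∀ {u v ε} → u ≤ ε + v → v ≤ ε + u → dV u v ≤ ε
  ≤+⇒dV≤ u≤ε+v v≤ε+u = ∨-least (⋀-lower _ u≤ε+v) (⋀-lower _ v≤ε+u)

  Positive : Subset Carrier
  Positive δ = 0# ≺ δ

  SumsOfPositives : Subset Carrier
  SumsOfPositives t = Σ[ δ ∈ Carrier ] Σ[ δ′ ∈ Carrier ]
                      (Positive δ × Positive δ′ × t ≡ δ + δ′)

  -- Each positive δ is δ + 0 = δ + ⋀ Positive (Raney), which bounds ⋀ SumsOfPositives.
  ⋀-sumsOfPositives≤0 : ⋀ SumsOfPositives ≤ 0#
  ⋀-sumsOfPositives≤0 =
    ≤-trans (⋀-greatest Positive ⋀Sums≤positive) (≡⇒≤ (sym (approx 0#)))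
    where
      ⋀Sums≤positive : ∀ {δ} → Positive δ → ⋀ SumsOfPositives ≤ δ
      ⋀Sums≤positive {δ} 0≺δ =
        ≤-trans (+-⋀-greatest δ Positive
                  (λ {δ′} 0≺δ′ → ⋀-lower _ (δ , δ′ , 0≺δ , 0≺δ′ , refl)))
                (≡⇒≤ (trans (cong (δ +_) (sym (approx 0#))) (+-identityʳ δ)))

  positive-halving : ∀ {ε} → 0# ≺ ε → Σ[ δ ∈ Carrier ] (0# ≺ δ × δ + δ ≤ ε)
  positive-halving 0≺ε
    with proj₁ ≺-def 0≺ε SumsOfPositives ⋀-sumsOfPositives≤0
  ... | _ , (δ , δ′ , 0≺δ , 0≺δ′ , refl) , δ+δ′≤ε =
    δ ∧ δ′ , ≺-∧ 0≺δ 0≺δ′ , ≤-trans (+-mono-≤ ∧-lowerˡ ∧-lowerʳ) δ+δ′≤ε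

  module _ {I : Set} (D : Ultrafilter I) where
    open Ultrafilter D

    IsLim-pointwise : ∀ {as : I → Carrier} {a} → (∀ i → as i ≡ a) → IsLim V D as a
    IsLim-pointwise {a = a} as≡a ε _ =
      upward (λ {i} _ → ≤+⇒dV≤ (≤-trans (x≤y+x a ε) (≡⇒≤ (cong (ε +_) (sym (as≡a i)))))
                               (≤-trans (≡⇒≤ (as≡a i)) (x≤y+x a ε)))
             full

    IsLim-+ : ∀ {bs cs : I → Carrier} {b c} → IsLim V D bs b → IsLim V D cs c →
              IsLim V D (λ i → bs i + cs i) (b + c)
    IsLim-+ bs→b cs→c ε 0≺ε with positive-halving 0≺ε
    ... | δ , 0≺δ , δ+δ≤ε =
      upward (λ (b≈bᵢ , c≈cᵢ) →
               ≤+⇒dV≤ (+-≤-+ (dV≤⇒≤+ˡ b≈bᵢ) (dV≤⇒≤+ˡ c≈cᵢ))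
                      (+-≤-+ (dV≤⇒≤+ʳ b≈bᵢ) (dV≤⇒≤+ʳ c≈cᵢ)))
             (meet (bs→b δ 0≺δ) (cs→c δ 0≺δ))
      where
        +-≤-+ : ∀ {u u′ v v′} → u ≤ δ + u′ → v ≤ δ + v′ → u + v ≤ ε + (u′ + v′)
        +-≤-+ {u′ = u′} {v′ = v′} u≤ v≤ =
          ≤-trans (+-mono-≤ u≤ v≤)
                  (≤-trans (≡⇒≤ (+-interchange δ u′ δ v′)) (+-monoˡ-≤ (u′ + v′) δ+δ≤ε))

    IsLim-∧-upper : ∀ {as ss : I → Carrier} {a s} → (∀ i → as i ≤ ss i) →
                    IsLim V D as a → IsLim V D ss s → IsLim V D as (a ∧ s)
    IsLim-∧-upper as≤ss as→a ss→s ε 0≺ε =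
      upward (λ {i} (a≈aᵢ , s≈sᵢ) →
               ≤+⇒dV≤ (≤-trans ∧-lowerˡ (dV≤⇒≤+ˡ a≈aᵢ))
                      (+-∧-greatest ε (dV≤⇒≤+ʳ a≈aᵢ) (≤-trans (as≤ss i) (dV≤⇒≤+ʳ s≈sᵢ))))
             (meet (as→a ε 0≺ε) (ss→s ε 0≺ε))

  module _ (U : UniqueUltralimits V) {I : Set} (D : Ultrafilter I) where

    lim-isLim : ∀ as → IsLim V D as (lim V U D as)
    lim-isLim as = proj₁ (proj₂ (U I D as))

    lim-unique : ∀ {as a} → IsLim V D as a → a ≡ lim V U D as
    lim-unique {as} {a} as→a = proj₂ (proj₂ (U I D as)) a as→a

    lim-mono : ∀ {as ss : I → Carrier} → (∀ i → as i ≤ ss i) → lim V U D as ≤ lim V U D ss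
    lim-mono {as} {ss} as≤ss =
      ≤-trans (≡⇒≤ (sym (lim-unique (IsLim-∧-upper D as≤ss (lim-isLim as) (lim-isLim ss)))))
              ∧-lowerʳ

    lim-+ : ∀ bs cs → lim V U D (λ i → bs i + cs i) ≡ lim V U D bs + lim V U D cs
    lim-+ bs cs = sym (lim-unique (IsLim-+ D (lim-isLim bs) (lim-isLim cs)))

mainTheorem16 : (V : ValueCoQuantale) (U : UniqueUltralimits V)
    (I : Set) (D : Ultrafilter I) (M : I → Set)
    (dM : ∀ i → M i → M i → ValueCoQuantale.Carrier V) →
    (∀ i → IsContinuitySpace V (M i) (dM i)) →
    IsContinuitySpace V ((i : I) → M i) (dD V U D M dM)
mainTheorem16 V U I D M dM isCS = dD-refl , dD-triangle
  where
    open ValueCoQuantale V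
    open Properties V

    dD-refl : ∀ x → dD V U D M dM x x ≡ 0#
    dD-refl x = sym (lim-unique U D (IsLim-pointwise D (λ i → proj₁ (isCS i) (x i))))

    dD-triangle : ∀ x y z → dD V U D M dM x y ≤ dD V U D M dM x z + dD V U D M dM z y
    dD-triangle x y z =
      ≤-trans (lim-mono U D (λ i → proj₂ (isCS i) (x i) (y i) (z i)))
              (≡⇒≤ (lim-+ U D (λ i → dM i (x i) (z i)) (λ i → dM i (z i) (y i))))
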